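{- There exists a constant $c > 0$ such that for every $r \ge 1$ and every $r$-regular graph $G$ on $n$ vertices, $\operatorname{fd}(G) \le n - c \log n$.
   Context: All graphs are finite and simple; $N(v)$ denotes the open neighborhood of $v$. For a graph $G=(V,E)$ and an integer $k \ge 1$, a $k$-fair dominating set is a dominating set $D \subseteq V$ such that $|N(v) \cap D| = k$ for every $v \in V \setminus D$ (the set $D = V$ qualifies vacuously). A fair dominating set (FD-set) is a set that is a $k$-fair dominating set for some $k \ge 1$. If $G$ has at least one edge, $\operatorname{fd}(G)$ is the minimum cardinality of an FD-set of $G$; by convention, $\operatorname{fd}(\overline{K_n}) = n$ for the edgeless graph on $n$ vertices. -}

module Defs where

open import Data.Nat using (ℕ; _≤_; _≥_)
open import Data.Bool using (Bool; false)
open import Data.Fin using (Fin)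
open import Data.Fin.Subset using (Subset; _∈_; _∉_; _∩_; ∣_∣)
open import Data.Vec using (tabulate)
open import Data.Product using (Σ; ∃; _×_)
open import Relation.Binary.PropositionalEquality using (_≡_)

record Graph (n : ℕ) : Set where
  field
    adj    : Fin n → Fin n → Bool
    sym    : ∀ u v → adj u v ≡ adj v u
    irrefl : ∀ v → adj v v ≡ false
open Graph public

N : ∀ {n} → Graph n → Fin n → Subset n
N G v = tabulate (adj G v)

Regular : ∀ {n} → ℕ → Graph n → Set
Regular r G = ∀ v → ∣ N G v ∣ ≡ r

Dominating : ∀ {n} → Graph n → Subset n → Set
Dominating G D = ∀ v → v ∉ D → Σ _ λ u → (u ∈ D × u ∈ N G v)

KFairDominating : ∀ {n} → ℕ → Graph n → Subset n → Set
KFairDominating k G D = Dominating G D × (∀ v → v ∉ D → ∣ N G v ∩ D ∣ ≡ k)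

FairDominating : ∀ {n} → Graph n → Subset n → Set
FairDominating G D = Σ ℕ λ k → (k ≥ 1 × KFairDominating k G D)

-- m = fd(G): m is the minimum cardinality of an FD-set of G.
-- (For the edgeless graph this also gives fd = n, since an FD-set D
--  of an edgeless graph must be all of V, unless n = 0.)
IsFd : ∀ {n} → Graph n → ℕ → Set
IsFd G m = (Σ _ λ D → FairDominating G D × ∣ D ∣ ≡ m)
         × (∀ D → FairDominating G D → m ≤ ∣ D ∣)

-- If every vertex of S has exactly s < r neighbours inside S, then in an r-regular graph
-- every vertex of S has exactly r − s neighbours outside S, so V ∖ S is an (r − s)-fair
-- dominating set and fd(G) ≤ n − |S|.  Independent sets (s = 0) qualify, and so do cliques
-- with at most r vertices (s = |C| − 1); since a clique of an r-regular graph has at most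
-- r + 1 vertices, every nonempty clique C yields fd(G) ≤ n − (|C| − 1).  By the
-- Erdős–Szekeres bound R(k, k) ≤ 4^k every graph on n vertices has a clique or an
-- independent set with about ½ log₂ n vertices: if d = n − fd(G) and n ≥ 4^(d+2), a
-- homogeneous set of size d + 2 would give fd(G) ≤ n − (d + 1) < fd(G).
module Submission where

open import Defs renaming (sym to adj-sym)
open import Data.Nat using (ℕ; zero; suc; pred; _+_; _*_; _∸_; _^_; _≤_; _<_; _≥_; _≰_; z≤n; s≤s; z<s)
open import Data.Nat.Properties
open import Data.Nat.Tactic.RingSolver using (solve-∀)
open import Data.Bool using (Bool; true; false)
open import Data.Fin using (Fin) renaming (zero to fzero)
open import Data.Fin.Properties using (toℕ<n)
open import Data.Fin.Subset
open import Data.Fin.Subset.Properties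
open import Data.Vec using (_∷_; [])
open import Data.Vec.Properties using (lookup∘tabulate; []=⇒lookup; lookup⇒[]=)
open import Data.Product using (Σ; _×_; _,_; proj₁; proj₂; swap)
open import Data.Sum as Sum using (_⊎_; inj₁; inj₂; [_,_]′)
open import Data.Empty using (⊥-elim)
open import Relation.Nullary using (yes; no; contradiction)
open import Relation.Binary.PropositionalEquality
  using (_≡_; _≢_; refl; sym; trans; cong; subst; subst₂; ≢-sym; module ≡-Reasoning)

∣p∩q∣+∣p∩∁q∣≡∣p∣ : ∀ {n} (p q : Subset n) → ∣ p ∩ q ∣ + ∣ p ∩ ∁ q ∣ ≡ ∣ p ∣
∣p∩q∣+∣p∩∁q∣≡∣p∣ []            []            = refl
∣p∩q∣+∣p∩∁q∣≡∣p∣ (inside ∷ p)  (inside ∷ q)  = cong suc (∣p∩q∣+∣p∩∁q∣≡∣p∣ p q)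
∣p∩q∣+∣p∩∁q∣≡∣p∣ (inside ∷ p)  (outside ∷ q) = trans (+-suc _ _) (cong suc (∣p∩q∣+∣p∩∁q∣≡∣p∣ p q))
∣p∩q∣+∣p∩∁q∣≡∣p∣ (outside ∷ p) (_ ∷ q)       = ∣p∩q∣+∣p∩∁q∣≡∣p∣ p q

x∈p⇒0<∣p∣ : ∀ {n} {x : Fin n} {p} → x ∈ p → 0 < ∣ p ∣
x∈p⇒0<∣p∣ x∈p = ≤-trans (s≤s z≤n) (x∈p⇒∣p-x∣<∣p∣ x∈p)

0<∣p∣⇒nonempty : ∀ {n} (p : Subset n) → 0 < ∣ p ∣ → Nonempty p
0<∣p∣⇒nonempty {n} p 0<∣p∣ with nonempty? p
... | yes ne   = ne
... | no empty =
  contradiction (subst (0 <_) (trans (cong ∣_∣ (Empty-unique empty)) (∣⊥∣≡0 n)) 0<∣p∣) n≮0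

x∈p⇒∣p∣≡1+∣p∩∁⁅x⁆∣ : ∀ {n} {x : Fin n} {p} → x ∈ p → ∣ p ∣ ≡ suc ∣ p ∩ ∁ ⁅ x ⁆ ∣
x∈p⇒∣p∣≡1+∣p∩∁⁅x⁆∣ {x = x} {p} x∈p = begin
  ∣ p ∣                             ≡⟨ ∣p∩q∣+∣p∩∁q∣≡∣p∣ p ⁅ x ⁆ ⟨
  ∣ p ∩ ⁅ x ⁆ ∣ + ∣ p ∩ ∁ ⁅ x ⁆ ∣ ≡⟨ cong (_+ ∣ p ∩ ∁ ⁅ x ⁆ ∣) ∣p∩⁅x⁆∣≡1 ⟩
  suc ∣ p ∩ ∁ ⁅ x ⁆ ∣             ∎
  where
  open ≡-Reasoning
  ∣p∩⁅x⁆∣≡1 : ∣ p ∩ ⁅ x ⁆ ∣ ≡ 1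
  ∣p∩⁅x⁆∣≡1 = ≤-antisym (subst (∣ p ∩ ⁅ x ⁆ ∣ ≤_) (∣⁅x⁆∣≡1 x) (∣p∩q∣≤∣q∣ p ⁅ x ⁆))
                        (x∈p⇒0<∣p∣ (x∈p∩q⁺ (x∈p , x∈⁅x⁆ x)))

k+k≤1+a+b⇒a<k⇒k≤b : ∀ {k a b} → k + k ≤ suc (a + b) → a < k → k ≤ b
k+k≤1+a+b⇒a<k⇒k≤b {k} {a} {b} k+k≤1+a+b a<k = +-cancelˡ-≤ k k b (≤-trans k+k≤1+a+b (+-monoˡ-≤ b a<k))

pred[m]<n : ∀ {m n} → 0 < n → m ≤ n → pred m < n
pred[m]<n {zero}  0<n _     = 0<n
pred[m]<n {suc m} _   1+m≤n = 1+m≤n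

m≰n∸[1+[n∸m]] : ∀ {m n} → 0 < m → m ≤ n → m ≰ n ∸ suc (n ∸ m)
m≰n∸[1+[n∸m]] {suc k} {n} _ m≤n m≤n∸[1+[n∸m]] =
  1+n≰n (subst (suc k ≤_) n∸[1+[n∸m]]≡k m≤n∸[1+[n∸m]])
  where
  n∸[1+[n∸m]]≡k : n ∸ suc (n ∸ suc k) ≡ k
  n∸[1+[n∸m]]≡k = trans (sym (pred[m∸n]≡m∸[1+n] n (n ∸ suc k))) (cong pred (m∸[m∸n]≡n m≤n))

2[d+2]≤6d : ∀ {d} → 0 < d → suc (suc d) + suc (suc d) ≤ 6 * d
2[d+2]≤6d {d} 0<d = subst₂ _≤_ (lhs d) (rhs d) (+-monoˡ-≤ (2 * d) (*-monoʳ-≤ 4 0<d))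
  where
  lhs : ∀ d → 4 * 1 + 2 * d ≡ suc (suc d) + suc (suc d)
  lhs = solve-∀
  rhs : ∀ d → 4 * d + 2 * d ≡ 6 * d
  rhs = solve-∀

Homogeneous : ∀ {n} → Bool → Graph n → Subset n → Set
Homogeneous b G C = ∀ {u w} → u ∈ C → w ∈ C → u ≢ w → adj G u w ≡ b

Clique Independent : ∀ {n} → Graph n → Subset n → Set
Clique G      = Homogeneous true G
Independent G = Homogeneous false G

HomogeneousIn : ∀ {n} → Bool → Graph n → Subset n → ℕ → Set
HomogeneousIn {n} b G W k = Σ (Subset n) λ C → C ⊆ W × k ≤ ∣ C ∣ × Homogeneous b G C

module _ {n : ℕ} (G : Graph n) where

  ∈N⇒adj : ∀ {v u} → u ∈ N G v → adj G v u ≡ true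
  ∈N⇒adj {v} {u} u∈Nv = trans (sym (lookup∘tabulate (adj G v) u)) ([]=⇒lookup u∈Nv)

  adj⇒∈N : ∀ {v u} → adj G v u ≡ true → u ∈ N G v
  adj⇒∈N {v} {u} vu = lookup⇒[]= u _ (trans (lookup∘tabulate (adj G v) u) vu)

  ∉N⇒¬adj : ∀ {v u} → u ∉ N G v → adj G v u ≡ false
  ∉N⇒¬adj {v} {u} u∉Nv with adj G v u in vu
  ... | true  = contradiction (adj⇒∈N vu) u∉Nv
  ... | false = refl

  ∈N⇒≢ : ∀ {v u} → u ∈ N G v → u ≢ v
  ∈N⇒≢ {v} u∈Nv refl = contradiction (trans (sym (∈N⇒adj u∈Nv)) (irrefl G v)) λ ()

  homogeneous-⊆ : ∀ {b C D} → D ⊆ C → Homogeneous b G C → Homogeneous b G D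
  homogeneous-⊆ D⊆C hom u∈D w∈D = hom (D⊆C u∈D) (D⊆C w∈D)

  homogeneous-⁅⁆ : ∀ {b} v → Homogeneous b G ⁅ v ⁆
  homogeneous-⁅⁆ v u∈v w∈v u≢w = ⊥-elim (u≢w (trans (x∈⁅y⁆⇒x≡y v u∈v) (sym (x∈⁅y⁆⇒x≡y v w∈v))))

  homogeneous-∪⁅⁆ : ∀ {b C v} → Homogeneous b G C → (∀ {u} → u ∈ C → adj G v u ≡ b) →
                    Homogeneous b G (C ∪ ⁅ v ⁆)
  homogeneous-∪⁅⁆ {C = C} {v} hom v~C {u} {w} u∈ w∈ u≢w
    with x∈p∪q⁻ C ⁅ v ⁆ u∈ | x∈p∪q⁻ C ⁅ v ⁆ w∈
  ... | inj₁ u∈C | inj₁ w∈C = hom u∈C w∈C u≢w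
  ... | inj₁ u∈C | inj₂ w∈v rewrite x∈⁅y⁆⇒x≡y v w∈v = trans (adj-sym G u v) (v~C u∈C)
  ... | inj₂ u∈v | inj₁ w∈C rewrite x∈⁅y⁆⇒x≡y v u∈v = v~C w∈C
  ... | inj₂ u∈v | inj₂ w∈v = homogeneous-⁅⁆ v u∈v w∈v u≢w

  independent-degree : ∀ {I v} → Independent G I → v ∈ I → ∣ N G v ∩ I ∣ ≡ 0
  independent-degree {I} {v} ind v∈I = trans (cong ∣_∣ (Empty-unique noNeighbour)) (∣⊥∣≡0 n)
    where
    noNeighbour : Empty (N G v ∩ I)
    noNeighbour (u , u∈) with x∈p∩q⁻ (N G v) I u∈
    ... | u∈Nv , u∈I = contradiction (trans (sym (∈N⇒adj u∈Nv)) (ind v∈I u∈I (≢-sym (∈N⇒≢ u∈Nv)))) λ ()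

  clique-degree : ∀ {C v} → Clique G C → v ∈ C → ∣ C ∣ ≡ suc ∣ N G v ∩ C ∣
  clique-degree {C} {v} cl v∈C =
    trans (x∈p⇒∣p∣≡1+∣p∩∁⁅x⁆∣ v∈C) (cong (λ X → suc ∣ X ∣) (⊆-antisym C-v⊆N∩C N∩C⊆C-v))
    where
    C-v⊆N∩C : C ∩ ∁ ⁅ v ⁆ ⊆ N G v ∩ C
    C-v⊆N∩C u∈ with x∈p∩q⁻ C (∁ ⁅ v ⁆) u∈
    ... | u∈C , u∉v = x∈p∩q⁺ (adj⇒∈N (cl v∈C u∈C (≢-sym (x∉⁅y⁆⇒x≢y (x∈∁p⇒x∉p u∉v)))) , u∈C)
    N∩C⊆C-v : N G v ∩ C ⊆ C ∩ ∁ ⁅ v ⁆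
    N∩C⊆C-v u∈ with x∈p∩q⁻ (N G v) C u∈
    ... | u∈Nv , u∈C = x∈p∩q⁺ (u∈C , x∉p⇒x∈∁p (x≢y⇒x∉⁅y⁆ (∈N⇒≢ u∈Nv)))

  clique-size : ∀ {r C v} → Regular r G → Clique G C → v ∈ C → ∣ C ∣ ≤ suc r
  clique-size {r} {C} {v} reg cl v∈C =
    subst (_≤ suc r) (sym (clique-degree cl v∈C)) (s≤s (subst (_ ≤_) (reg v) (∣p∩q∣≤∣p∣ (N G v) C)))

  homogeneousIn-zero : ∀ {b W} → HomogeneousIn b G W 0
  homogeneousIn-zero = ⊥ , ⊥⊆ , z≤n , λ u∈⊥ → ⊥-elim (∉⊥ u∈⊥)

  homogeneousIn-⊆ : ∀ {b W W′ k} → W ⊆ W′ → HomogeneousIn b G W k → HomogeneousIn b G W′ k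
  homogeneousIn-⊆ W⊆W′ (C , C⊆W , k≤∣C∣ , hom) = C , ⊆-trans C⊆W W⊆W′ , k≤∣C∣ , hom

  homogeneousIn-extend : ∀ {b W U k v} → v ∈ W → U ⊆ W ∩ ∁ ⁅ v ⁆ → (∀ {u} → u ∈ U → adj G v u ≡ b) →
                         HomogeneousIn b G U k → HomogeneousIn b G W (suc k)
  homogeneousIn-extend {W = W} {v = v} v∈W U⊆W-v v~U (C , C⊆U , k≤∣C∣ , hom) =
    C ∪ ⁅ v ⁆ , C∪v⊆W , ≤-trans (s≤s k≤∣C∣) (p⊂q⇒∣p∣<∣q∣ C⊂C∪v) ,
    homogeneous-∪⁅⁆ hom (λ u∈C → v~U (C⊆U u∈C))
    where
    C⊆W-v : C ⊆ W ∩ ∁ ⁅ v ⁆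
    C⊆W-v = ⊆-trans C⊆U U⊆W-v
    C⊂C∪v : C ⊂ C ∪ ⁅ v ⁆
    C⊂C∪v = p⊆p∪q ⁅ v ⁆ , v , x∈p∪q⁺ (inj₂ (x∈⁅x⁆ v)) ,
            λ v∈C → x∈∁p⇒x∉p (p∩q⊆q W _ (C⊆W-v v∈C)) (x∈⁅x⁆ v)
    C∪v⊆W : C ∪ ⁅ v ⁆ ⊆ W
    C∪v⊆W u∈ with x∈p∪q⁻ C ⁅ v ⁆ u∈
    ... | inj₁ u∈C = p∩q⊆p W _ (C⊆W-v u∈C)
    ... | inj₂ u∈v = subst (_∈ W) (sym (x∈⁅y⁆⇒x≡y v u∈v)) v∈W

  ramsey : ∀ s t (W : Subset n) → 2 ^ (s + t) ≤ ∣ W ∣ →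
           HomogeneousIn true G W s ⊎ HomogeneousIn false G W t
  ramsey zero    t       W _   = inj₁ homogeneousIn-zero
  ramsey (suc s) zero    W _   = inj₂ homogeneousIn-zero
  ramsey (suc s) (suc t) W big with 0<∣p∣⇒nonempty W (≤-trans (m^n>0 2 (suc s + suc t)) big)
  ... | v , v∈W = [ viaNeighbours , viaNonNeighbours ]′ (≤-<-connex K ∣ A ∣)
    where
    W′ = W ∩ ∁ ⁅ v ⁆
    A  = W′ ∩ N G v
    B  = W′ ∩ ∁ (N G v)
    K  = 2 ^ (s + suc t)
    W′⊆W : W′ ⊆ W
    W′⊆W = p∩q⊆p W (∁ ⁅ v ⁆)
    K+K≤1+∣A∣+∣B∣ : K + K ≤ suc (∣ A ∣ + ∣ B ∣)
    K+K≤1+∣A∣+∣B∣ = subst₂ _≤_ (cong (K +_) (+-identityʳ K))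
      (trans (x∈p⇒∣p∣≡1+∣p∩∁⁅x⁆∣ v∈W) (cong suc (sym (∣p∩q∣+∣p∩∁q∣≡∣p∣ W′ (N G v))))) big
    viaNeighbours : K ≤ ∣ A ∣ → HomogeneousIn true G W (suc s) ⊎ HomogeneousIn false G W (suc t)
    viaNeighbours K≤∣A∣ =
      Sum.map (homogeneousIn-extend v∈W (p∩q⊆p W′ (N G v)) (λ u∈A → ∈N⇒adj (p∩q⊆q W′ (N G v) u∈A)))
              (homogeneousIn-⊆ (⊆-trans (p∩q⊆p W′ (N G v)) W′⊆W))
              (ramsey s (suc t) A K≤∣A∣)
    viaNonNeighbours : ∣ A ∣ < K → HomogeneousIn true G W (suc s) ⊎ HomogeneousIn false G W (suc t)
    viaNonNeighbours ∣A∣<K =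
      Sum.map (homogeneousIn-⊆ (⊆-trans (p∩q⊆p W′ (∁ (N G v))) W′⊆W))
              (homogeneousIn-extend v∈W (p∩q⊆p W′ (∁ (N G v)))
                 (λ u∈B → ∉N⇒¬adj (x∈∁p⇒x∉p (p∩q⊆q W′ (∁ (N G v)) u∈B))))
              (ramsey (suc s) t B (subst (λ e → 2 ^ e ≤ ∣ B ∣) (+-suc s t)
                                         (k+k≤1+a+b⇒a<k⇒k≤b K+K≤1+∣A∣+∣B∣ ∣A∣<K)))

∁-fairDominating : ∀ {n r s} (G : Graph n) (S : Subset n) → Regular r G → s < r →
                   (∀ {v} → v ∈ S → ∣ N G v ∩ S ∣ ≡ s) → FairDominating G (∁ S)
∁-fairDominating {r = r} {s} G S reg s<r deg = r ∸ s , m<n⇒0<n∸m s<r , dominating , fair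
  where
  fair : ∀ v → v ∉ ∁ S → ∣ N G v ∩ ∁ S ∣ ≡ r ∸ s
  fair v v∉∁S = begin
    ∣ N G v ∩ ∁ S ∣                      ≡⟨ m+n∸m≡n s _ ⟨
    s + ∣ N G v ∩ ∁ S ∣ ∸ s              ≡⟨ cong (λ k → k + _ ∸ s) (deg (x∉∁p⇒x∈p v∉∁S)) ⟨
    ∣ N G v ∩ S ∣ + ∣ N G v ∩ ∁ S ∣ ∸ s  ≡⟨ cong (_∸ s) (∣p∩q∣+∣p∩∁q∣≡∣p∣ (N G v) S) ⟩
    ∣ N G v ∣ ∸ s                        ≡⟨ cong (_∸ s) (reg v) ⟩
    r ∸ s                                ∎
    where open ≡-Reasoning
  dominating : Dominating G (∁ S)
  dominating v v∉∁S
    with 0<∣p∣⇒nonempty (N G v ∩ ∁ S) (subst (0 <_) (sym (fair v v∉∁S)) (m<n⇒0<n∸m s<r))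
  ... | u , u∈ = u , swap (x∈p∩q⁻ (N G v) (∁ S) u∈)

dominating⇒nonempty : ∀ {n} (G : Graph n) {D} → Dominating G D → Fin n → Nonempty D
dominating⇒nonempty G {D} dom v with v ∈? D
... | yes v∈D = v , v∈D
... | no v∉D  = proj₁ (dom v v∉D) , proj₁ (proj₂ (dom v v∉D))

module _ {n r m} (G : Graph n) (reg : Regular r G) (0<r : 0 < r) (isFd : IsFd G m) where

  fd≤n : m ≤ n
  fd≤n with proj₁ isFd
  ... | D , _ , ∣D∣≡m = subst (_≤ n) ∣D∣≡m (∣p∣≤n D)

  fd-positive : Fin n → 0 < m
  fd-positive v with proj₁ isFd
  ... | D , (_ , _ , dom , _) , ∣D∣≡m =
    subst (0 <_) ∣D∣≡m (x∈p⇒0<∣p∣ (proj₂ (dominating⇒nonempty G dom v)))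

  fd≤n∸∣S∣ : ∀ S → FairDominating G (∁ S) → m ≤ n ∸ ∣ S ∣
  fd≤n∸∣S∣ S fair = subst (m ≤_) (∣∁p∣≡n∸∣p∣ S) (proj₂ isFd (∁ S) fair)

  independent⇒fd≤ : ∀ {I} → Independent G I → m ≤ n ∸ ∣ I ∣
  independent⇒fd≤ {I} ind = fd≤n∸∣S∣ I (∁-fairDominating G I reg 0<r (independent-degree G ind))

  clique⇒fd≤ : ∀ {C} → Clique G C → ∣ C ∣ ≤ r → m ≤ n ∸ ∣ C ∣
  clique⇒fd≤ {C} cl ∣C∣≤r = fd≤n∸∣S∣ C (∁-fairDominating G C reg (pred[m]<n 0<r ∣C∣≤r) deg)
    where
    deg : ∀ {v} → v ∈ C → ∣ N G v ∩ C ∣ ≡ pred ∣ C ∣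
    deg v∈C = cong pred (sym (clique-degree G cl v∈C))

  clique∋⇒fd≤ : ∀ {C v} → Clique G C → v ∈ C → m ≤ n ∸ pred ∣ C ∣
  clique∋⇒fd≤ {C} {v} cl v∈C = subst (λ k → m ≤ n ∸ k) (sym pred∣C∣≡∣C-v∣)
    (clique⇒fd≤ (homogeneous-⊆ G (p∩q⊆p C _) cl)
                (≤-pred (subst (_≤ suc r) ∣C∣≡1+∣C-v∣ (clique-size G reg cl v∈C))))
    where
    ∣C∣≡1+∣C-v∣ : ∣ C ∣ ≡ suc ∣ C ∩ ∁ ⁅ v ⁆ ∣
    ∣C∣≡1+∣C-v∣ = x∈p⇒∣p∣≡1+∣p∩∁⁅x⁆∣ v∈C
    pred∣C∣≡∣C-v∣ : pred ∣ C ∣ ≡ ∣ C ∩ ∁ ⁅ v ⁆ ∣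
    pred∣C∣≡∣C-v∣ = cong pred ∣C∣≡1+∣C-v∣

  fd≤n∸k : ∀ k → 2 ^ (suc k + suc k) ≤ n → m ≤ n ∸ k
  fd≤n∸k k big =
    [ viaClique , viaIndependent ]′ (ramsey G (suc k) (suc k) ⊤ (subst (_ ≤_) (sym (∣⊤∣≡n n)) big))
    where
    viaClique : HomogeneousIn true G ⊤ (suc k) → m ≤ n ∸ k
    viaClique (C , _ , k<∣C∣ , cl) with 0<∣p∣⇒nonempty C (≤-trans (s≤s z≤n) k<∣C∣)
    ... | v , v∈C = ≤-trans (clique∋⇒fd≤ cl v∈C) (∸-monoʳ-≤ n (suc[m]≤n⇒m≤pred[n] k<∣C∣))
    viaIndependent : HomogeneousIn false G ⊤ (suc k) → m ≤ n ∸ k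
    viaIndependent (I , _ , k<∣I∣ , ind) = ≤-trans (independent⇒fd≤ ind) (∸-monoʳ-≤ n (<⇒≤ k<∣I∣))

  fd-logarithmic : Fin n → n ≤ 2 ^ (6 * (n ∸ m))
  fd-logarithmic v = ≮⇒≥ λ 2^6d<n → m≰n∸[1+[n∸m]] (fd-positive v) fd≤n
    (fd≤n∸k (suc (n ∸ m)) (≤-trans (^-monoʳ-≤ 2 (2[d+2]≤6d 0<n∸m)) (<⇒≤ 2^6d<n)))
    where
    m≤n∸1 : m ≤ n ∸ 1
    m≤n∸1 = subst (λ k → m ≤ n ∸ k) (∣⁅x⁆∣≡1 v) (independent⇒fd≤ (homogeneous-⁅⁆ G v))
    0<n∸m : 0 < n ∸ m
    0<n∸m = m<n⇒0<n∸m (≤-<-trans m≤n∸1 (∸-monoʳ-< z<s (≤-<-trans z≤n (toℕ<n v))))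

proposition4 : Σ ℕ λ a → Σ ℕ λ b → a ≥ 1 × b ≥ 1 ×
    (∀ (r n : ℕ) → r ≥ 1 → (G : Graph n) → Regular r G →
      ∀ m → IsFd G m → 2 ^ (b * (n ∸ m)) ≥ n ^ a)
proposition4 = 1 , 6 , s≤s z≤n , s≤s z≤n , bound
  where
  bound : ∀ (r n : ℕ) → r ≥ 1 → (G : Graph n) → Regular r G →
          ∀ m → IsFd G m → 2 ^ (6 * (n ∸ m)) ≥ n ^ 1
  bound _ zero    _   _ _   _ _    = z≤n
  bound _ (suc n) 0<r G reg m isFd =
    subst (_≤ 2 ^ (6 * (suc n ∸ m))) (sym (^-identityʳ (suc n))) (fd-logarithmic G reg 0<r isFd fzero)
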